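{- For all integers $n\ge0$ and $p\ge0$, $$(xD)^{p+1}\varphi_n(x) = (xD)^p\varphi_{n+1}(x) - x\sum_{j=0}^p\binom{p}{j}(xD)^j\varphi_n(x).$$
   Context: $S(n,k)$ are the Stirling numbers of the second kind and $\varphi_n(x) = \sum_{k=0}^n S(n,k)x^k$ are the exponential polynomials. $D = \frac{d}{dx}$, and $(xD)$ is the operator $f\mapsto x f'(x)$, with $(xD)^0$ the identity. -}

module Defs where

open import Data.Nat using (ℕ; zero; suc)
open import Data.Nat.Combinatorics using (_C_)
open import Data.Integer using (ℤ; +_; _+_; _*_; _-_)

-- Stirling numbers of the second kind: S(0,0)=1, S(0,k+1)=0, S(n+1,0)=0,
-- S(n+1,k+1) = (k+1) S(n,k+1) + S(n,k).
S : ℕ → ℕ → ℕ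
S zero    zero    = 1
S zero    (suc k) = 0
S (suc n) zero    = 0
S (suc n) (suc k) = suc k Data.Nat.* S n (suc k) Data.Nat.+ S n k

-- Polynomials with integer coefficients, represented by their coefficient
-- sequence: Poly f means coefficient of x^k is f k.  All polynomials below
-- have finite support; equality of polynomials = equality of all coefficients.
Poly : Set
Poly = ℕ → ℤ

-- exponential polynomial φ_n(x) = Σ_{k=0}^n S(n,k) x^k   (S(n,k)=0 for k>n)
φ : ℕ → Poly
φ n k = + S n k

xD : Poly → Poly
xD f k = + k * f k

xD^ : ℕ → Poly → Poly
xD^ zero    f = f
xD^ (suc p) f = xD (xD^ p f)

mulX : Poly → Poly
mulX f zero    = + 0
mulX f (suc k) = f k

_⊕_ : Poly → Poly → Poly
(f ⊕ g) k = f k + g k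

_⊖_ : Poly → Poly → Poly
(f ⊖ g) k = f k - g k

_·_ : ℕ → Poly → Poly
(c · f) k = + c * f k

zeroP : Poly
zeroP _ = + 0

ΣP : ℕ → (ℕ → Poly) → Poly
ΣP zero    g = g zero
ΣP (suc p) g = ΣP p g ⊕ g (suc p)

-- The Stirling recurrence says φ_{n+1} = xD φ_n + x φ_n. Applying (xD)^p and using
-- xD ∘ x = x ∘ (1 + xD), hence (xD)^p ∘ x = x ∘ (1 + xD)^p, gives
-- (xD)^p φ_{n+1} = (xD)^{p+1} φ_n + x (1 + xD)^p φ_n, and the binomial theorem expands
-- (1 + xD)^p = Σ_j C(p,j) (xD)^j. On coefficients (xD)^p acts as multiplication by k^p,
-- so the binomial step is the numerical identity Σ_j C(p,j) m^j = (1 + m)^p.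
module Submission where

open import Defs
open import Data.Nat using (ℕ; zero; suc; _^_; _∸_)
import Data.Nat as ℕ
import Data.Nat.Properties as ℕ
open import Data.Nat.Combinatorics using (_C_)
open import Data.Integer using (+_; _+_; _*_; _-_)
import Data.Integer.Properties as ℤ
open import Data.Fin using (Fin; toℕ)
open import Data.Fin.Properties using (toℕ-inject₁; toℕ-fromℕ)
open import Function using (_∘_)
open import Relation.Binary.PropositionalEquality
  using (_≡_; refl; sym; trans; cong; cong₂; _≗_; module ≡-Reasoning)

open import Algebra.Bundles using (AbelianGroup)
open import Algebra.Properties.Group (AbelianGroup.group ℤ.+-0-abelianGroup)
  using (//-rightDividesʳ)
open import Algebra.Properties.Semiring.Sum ℕ.+-*-semiring using (sum; sum-init-last; sum-cong-≗)
open import Algebra.Properties.Semiring.Mult ℕ.+-*-semiring using (_×_)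
import Algebra.Properties.Semiring.Exp ℕ.+-*-semiring as Exp
import Algebra.Properties.CommutativeSemiring.Binomial ℕ.+-*-commutativeSemiring as Binomial

open ≡-Reasoning

×≗* : ∀ n m → n × m ≡ n ℕ.* m
×≗* zero    m = refl
×≗* (suc n) m = cong (m ℕ.+_) (×≗* n m)

^≗^ : ∀ m n → m Exp.^ n ≡ m ^ n
^≗^ m zero    = refl
^≗^ m (suc n) = cong (m ℕ.*_) (^≗^ m n)

binomial-sum : ∀ p m → sum (λ (j : Fin (suc p)) → (p C toℕ j) ℕ.* m ^ toℕ j) ≡ suc m ^ p
binomial-sum p m = begin
  sum (λ (j : Fin (suc p)) → (p C toℕ j) ℕ.* m ^ toℕ j)
    ≡⟨ sum-cong-≗ term ⟨
  Binomial.binomialExpansion m 1 p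
    ≡⟨ Binomial.theorem p m 1 ⟨
  (m ℕ.+ 1) Exp.^ p
    ≡⟨ trans (^≗^ (m ℕ.+ 1) p) (cong (_^ p) (ℕ.+-comm m 1)) ⟩
  suc m ^ p ∎
  where
  term : ∀ j → Binomial.binomialTerm m 1 p j ≡ (p C toℕ j) ℕ.* m ^ toℕ j
  term j = begin
    (p C toℕ j) × (m Exp.^ toℕ j ℕ.* 1 Exp.^ (p ∸ toℕ j))
      ≡⟨ ×≗* (p C toℕ j) _ ⟩
    (p C toℕ j) ℕ.* (m Exp.^ toℕ j ℕ.* 1 Exp.^ (p ∸ toℕ j))
      ≡⟨ cong ((p C toℕ j) ℕ.*_) (cong₂ ℕ._*_ (^≗^ m (toℕ j)) (^≗^ 1 (p ∸ toℕ j))) ⟩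
    (p C toℕ j) ℕ.* (m ^ toℕ j ℕ.* 1 ^ (p ∸ toℕ j))
      ≡⟨ cong (λ u → (p C toℕ j) ℕ.* (m ^ toℕ j ℕ.* u)) (ℕ.^-zeroˡ (p ∸ toℕ j)) ⟩
    (p C toℕ j) ℕ.* (m ^ toℕ j ℕ.* 1)
      ≡⟨ cong ((p C toℕ j) ℕ.*_) (ℕ.*-identityʳ (m ^ toℕ j)) ⟩
    (p C toℕ j) ℕ.* m ^ toℕ j ∎

sum-toℕ-init-last : ∀ p (h : ℕ → ℕ) →
  sum (λ (j : Fin (suc (suc p))) → h (toℕ j)) ≡ sum (λ (j : Fin (suc p)) → h (toℕ j)) ℕ.+ h (suc p)
sum-toℕ-init-last p h = trans (sum-init-last {suc p} (h ∘ toℕ))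
  (cong₂ ℕ._+_ (sum-cong-≗ {suc p} (λ j → cong h (toℕ-inject₁ j))) (cong h (toℕ-fromℕ (suc p))))

xD^-coeff : ∀ p (f : Poly) k → xD^ p f k ≡ + (k ^ p) * f k
xD^-coeff zero    f k = sym (ℤ.*-identityˡ (f k))
xD^-coeff (suc p) f k = begin
  + k * xD^ p f k               ≡⟨ cong (+ k *_) (xD^-coeff p f k) ⟩
  + k * (+ (k ^ p) * f k)       ≡⟨ ℤ.*-assoc (+ k) _ _ ⟨
  (+ k * + (k ^ p)) * f k       ≡⟨ cong (_* f k) (ℤ.pos-* k (k ^ p)) ⟨
  + (k ^ suc p) * f k           ∎

xD^-cong : ∀ p {f g : Poly} → f ≗ g → xD^ p f ≗ xD^ p g
xD^-cong zero    f≗g k = f≗g k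
xD^-cong (suc p) f≗g k = cong (+ k *_) (xD^-cong p f≗g k)

xD^-⊕ : ∀ p (f g : Poly) → xD^ p (f ⊕ g) ≗ xD^ p f ⊕ xD^ p g
xD^-⊕ zero    f g k = refl
xD^-⊕ (suc p) f g k = trans (cong (+ k *_) (xD^-⊕ p f g k)) (ℤ.*-distribˡ-+ (+ k) _ _)

xD^-xD : ∀ p (f : Poly) → xD^ p (xD f) ≗ xD^ (suc p) f
xD^-xD zero    f k = refl
xD^-xD (suc p) f k = cong (+ k *_) (xD^-xD p f k)

ΣP-cong-at : ∀ p {g h : ℕ → Poly} {k} → (∀ j → g j k ≡ h j k) → ΣP p g k ≡ ΣP p h k
ΣP-cong-at zero    g≡h = g≡h zero
ΣP-cong-at (suc p) g≡h = cong₂ _+_ (ΣP-cong-at p g≡h) (g≡h (suc p))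

ΣP-· : ∀ p (c : ℕ → ℕ) (f : Poly) k →
  ΣP p (λ j → c j · f) k ≡ + sum (λ (j : Fin (suc p)) → c (toℕ j)) * f k
ΣP-· zero    c f k = cong (λ s → + s * f k) (sym (ℕ.+-identityʳ (c 0)))
ΣP-· (suc p) c f k = begin
  ΣP p (λ j → c j · f) k + + c (suc p) * f k
    ≡⟨ cong (_+ + c (suc p) * f k) (ΣP-· p c f k) ⟩
  + s * f k + + c (suc p) * f k
    ≡⟨ ℤ.*-distribʳ-+ (f k) (+ s) (+ c (suc p)) ⟨
  (+ s + + c (suc p)) * f k
    ≡⟨ cong (_* f k) (trans (cong +_ (sum-toℕ-init-last p c)) (ℤ.pos-+ s (c (suc p)))) ⟨
  + sum (λ (j : Fin (suc (suc p))) → c (toℕ j)) * f k ∎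
  where s = sum (λ (j : Fin (suc p)) → c (toℕ j))

ΣP-binomial : ∀ p (f : Poly) m → ΣP p (λ j → (p C j) · xD^ j f) m ≡ + (suc m ^ p) * f m
ΣP-binomial p f m = begin
  ΣP p (λ j → (p C j) · xD^ j f) m
    ≡⟨ ΣP-cong-at p scale ⟩
  ΣP p (λ j → ((p C j) ℕ.* m ^ j) · f) m
    ≡⟨ ΣP-· p (λ j → (p C j) ℕ.* m ^ j) f m ⟩
  + sum (λ (j : Fin (suc p)) → (p C toℕ j) ℕ.* m ^ toℕ j) * f m
    ≡⟨ cong (λ s → + s * f m) (binomial-sum p m) ⟩
  + (suc m ^ p) * f m ∎
  where
  scale : ∀ j → ((p C j) · xD^ j f) m ≡ (((p C j) ℕ.* m ^ j) · f) m
  scale j = begin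
    + (p C j) * xD^ j f m             ≡⟨ cong (+ (p C j) *_) (xD^-coeff j f m) ⟩
    + (p C j) * (+ (m ^ j) * f m)     ≡⟨ ℤ.*-assoc (+ (p C j)) _ _ ⟨
    (+ (p C j) * + (m ^ j)) * f m     ≡⟨ cong (_* f m) (ℤ.pos-* (p C j) (m ^ j)) ⟨
    + ((p C j) ℕ.* m ^ j) * f m       ∎

xD^-mulX : ∀ p (f : Poly) → xD^ p (mulX f) ≗ mulX (ΣP p (λ j → (p C j) · xD^ j f))
xD^-mulX zero    f zero    = refl
xD^-mulX (suc p) f zero    = refl
xD^-mulX p       f (suc m) = trans (xD^-coeff p (mulX f) (suc m)) (sym (ΣP-binomial p f m))

φ-suc : ∀ n → φ (suc n) ≗ xD (φ n) ⊕ mulX (φ n)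
φ-suc n zero    = refl
φ-suc n (suc k) = trans (ℤ.pos-+ _ (S n k)) (cong (_+ + S n k) (ℤ.pos-* (suc k) (S n (suc k))))

lemma8 : (n p : ℕ) → (k : ℕ) →
    xD^ (suc p) (φ n) k
    ≡ (xD^ p (φ (suc n)) ⊖ mulX (ΣP p (λ j → (p C j) · xD^ j (φ n)))) k
lemma8 n p k = begin
  xD^ (suc p) (φ n) k
    ≡⟨ xD^-xD p (φ n) k ⟨
  xD^ p (xD (φ n)) k
    ≡⟨ //-rightDividesʳ (xD^ p (mulX (φ n)) k) _ ⟨
  xD^ p (xD (φ n)) k + xD^ p (mulX (φ n)) k - xD^ p (mulX (φ n)) k
    ≡⟨ cong (_- xD^ p (mulX (φ n)) k) (xD^-⊕ p (xD (φ n)) (mulX (φ n)) k) ⟨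
  xD^ p (xD (φ n) ⊕ mulX (φ n)) k - xD^ p (mulX (φ n)) k
    ≡⟨ cong₂ _-_ (sym (xD^-cong p (φ-suc n) k)) (xD^-mulX p (φ n) k) ⟩
  xD^ p (φ (suc n)) k - mulX (ΣP p (λ j → (p C j) · xD^ j (φ n))) k ∎
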